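{- Let $n\ge1$, let $T,T'\in\mathcal{C}_n$, $S\in\operatorname{Sel}(T)$ and $S'\in\operatorname{Sel}(T')$. If $\varphi(S,T)=\varphi(S',T')$, then $T=T'$ and $S=S'$.
   Context: $\mathcal{C}_n$ is the set of trees on vertex set $[n]$ (vertices are their own labels), rooted at $1$; edges $(i,j)$ are oriented from parent $i$ to child $j$. For a vertex $v$, $\beta_T(v)$ is the smallest label among descendants of $v$ ($v$ included). An edge $(i,j)$ is improper if $i>\beta_T(j)$, and $j$ is then an improper child of $i$; a vertex with at least one improper child is an improper parent. For an improper parent $a$, let $I(a)=\{b_1,\dots,b_k\}$ be its improper children, indexed so that $\beta_T(b_1)<\dots<\beta_T(b_k)$. A selection function $S\in\operatorname{Sel}(T)$ assigns to each improper parent $a$ a subset $S(a)\subseteq I(a)$. Given an improper parent $a$ and $S(a)=\{b_{i_1},\dots,b_{i_j}\}$ with $i_1<\dots<i_j$ (set $i_0=0$), the tree $\varphi_{a,S(a)}(T)$ is obtained by inserting a chain of $j$ new unlabelled vertices $u_1,\dots,u_j$ between $a$ and its parent $p$ (so the path becomes $p\to u_1\to u_2\to\dots\to u_j\to a$), and, for each $m\in\{1,\dots,j\}$, detaching every child $c$ of $a$ with $\beta_T(b_{i_{m-1}+1})\le\beta_T(c)\le\beta_T(b_{i_m})$ from $a$ and attaching it as a child of $u_m$ (with its subtree). These operations for distinct improper parents commute, and $\varphi(S,T)$ denotes the result of applying $\varphi_{a,S(a)}$ for all improper parents $a$ of $T$ (the result is a Greg tree: a tree with $n$ labelled vertices and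 unlabelled vertices of degree at least $3$, rooted at $1$). -}

module Defs where

open import Data.Nat as ℕ using (ℕ; zero; suc)
open import Data.Fin as Fin using (Fin; toℕ; _<_; _≤_; _≟_)
open import Data.Fin.Subset using (Subset; _∈_; _∉_)
open import Data.List using (List; foldr; upTo; allFin)
open import Data.Bool.ListAction using (any)
open import Data.Bool using (Bool; if_then_else_)
open import Data.Product using (Σ; ∃; ∃-syntax; _×_; _,_)
open import Data.Sum using (_⊎_; inj₁; inj₂)
open import Data.Empty using (⊥)
open import Relation.Nullary using (¬_)
open import Relation.Nullary.Decidable using (⌊_⌋)
open import Relation.Binary.PropositionalEquality using (_≡_; _≢_)
open import Function.Bundles using (_↔_; _⇔_; Inverse)

iter : {A : Set} → (A → A) → ℕ → A → A
iter f zero    x = x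
iter f (suc k) x = f (iter f k x)

-- Vertex i : Fin n stands for label (toℕ i + 1); the order of labels is the
-- order of Fin n.  The root (label 1) is Fin.zero.
-- A rooted tree on [n] is given by its parent map (edges parent v → v for
-- v ≠ root); by convention the root is its own "parent"; acyclicity/
-- connectedness: every vertex reaches the root by iterating parent.
record Tree (n : ℕ) : Set where
  field
    parent      : Fin (suc n) → Fin (suc n)
    parent-root : parent Fin.zero ≡ Fin.zero
    reaches     : ∀ v → ∃[ k ] iter parent k v ≡ Fin.zero
open Tree public

-- 𝒞_n with n = suc m
𝒞 : ℕ → Set
𝒞 m = Tree m

module _ {m : ℕ} (T : Tree m) where
  private
    V = Fin (suc m)

  Child : V → V → Set
  Child a c = (c ≢ Fin.zero) × (parent T c ≡ a)

  -- is u a descendant of v (u = v allowed)?  In a tree on suc m vertices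
  -- the path from u up to an ancestor has length ≤ m.
  desc? : V → V → Bool
  desc? u v = any (λ k → ⌊ iter (parent T) k u ≟ v ⌋) (upTo (suc m))

  minF : V → V → V
  minF x y = if ⌊ toℕ x ℕ.<? toℕ y ⌋ then x else y

  β : V → V
  β v = foldr (λ u acc → if desc? u v then minF u acc else acc) v
              (allFin (suc m))

  ImpChild : V → V → Set
  ImpChild a b = Child a b × (β b < a)

  record Sel : Set where
    field
      sel   : V → Subset (suc m)
      sound : ∀ a b → b ∈ sel a → ImpChild a b
  open Sel public

-- Greg trees: n labelled vertices Fin (suc m), an arbitrary type U of
-- unlabelled vertices, and the parent relation  Par x y  ("y is the parent of x").
record GregTree (m : ℕ) : Set₁ where
  field
    U   : Set
    Par : Fin (suc m) ⊎ U → Fin (suc m) ⊎ U → Set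
open GregTree public

liftV : {m : ℕ} {A B : Set} → (A → B) → Fin (suc m) ⊎ A → Fin (suc m) ⊎ B
liftV f (inj₁ v) = inj₁ v
liftV f (inj₂ u) = inj₂ (f u)

-- Equality of Greg trees: labelled vertices are identified by their labels,
-- unlabelled vertices only up to a bijection preserving the parent relation.
_≅G_ : {m : ℕ} → GregTree m → GregTree m → Set
_≅G_ {m} G H = Σ (U G ↔ U H) λ f →
  ∀ x y → Par G x y ⇔ Par H (liftV {m} (Inverse.to f) x) (liftV {m} (Inverse.to f) y)

module _ {m : ℕ} (T : Tree m) (S : Sel T) where
  private
    V = Fin (suc m)
    β' = β T
    s = sel S

  -- new unlabelled vertices: one for every selected improper child b of its
  -- parent a = parent b (b = b_{i_ℓ} gives the vertex u_ℓ of a's chain)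
  NewV : Set
  NewV = Σ V λ b → b ∈ s (parent T b)

  FirstSel : V → V → Set
  FirstSel a b = b ∈ s a × (∀ b' → b' ∈ s a → β' b ≤ β' b')
  LastSel : V → V → Set
  LastSel a b = b ∈ s a × (∀ b' → b' ∈ s a → β' b' ≤ β' b)
  -- b' = b_{i_{ℓ-1}} and b = b_{i_ℓ}
  PredSel : V → V → V → Set
  PredSel a b' b = b' ∈ s a × b ∈ s a × β' b' < β' b
                 × (∀ b'' → b'' ∈ s a → β' b' < β' b'' → ¬ (β' b'' < β' b))

  -- β_T(b_{i_{ℓ-1}+1}) ≤ β_T(c), where b = b_{i_ℓ}: b_{i_{ℓ-1}+1} is the
  -- β-smallest improper child d of a lying β-above every selected child
  -- β-below b; "min ≤ β c" is written as "some such d has β d ≤ β c".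
  LowerOK : V → V → V → Set
  LowerOK a b c = ∃[ d ] ImpChild T a d
                × (∀ b'' → b'' ∈ s a → β' b'' < β' b → β' b'' < β' d)
                × (β' d ≤ β' c)

  -- the child c of a = parent c is moved to the vertex u_ℓ of b = b_{i_ℓ}
  MovedTo : V → V → Set
  MovedTo c b = Child T (parent T c) c × b ∈ s (parent T c)
              × LowerOK (parent T c) b c × (β' c ≤ β' b)

  -- the parent of the "top" of v (v itself, or u_1 of v's chain) in φ(S,T)
  Outer : V → V ⊎ NewV → Set
  Outer v (inj₁ p)       = Child T p v × (∀ b → ¬ MovedTo v b)
  Outer v (inj₂ (b , _)) = MovedTo v b

  TopOf : V → V ⊎ NewV → Set
  TopOf v (inj₁ _)       = ⊥
  TopOf v (inj₂ (b , _)) = LastSel v b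

  PredY : V → V → V ⊎ NewV → Set
  PredY a b (inj₁ _)        = ⊥
  PredY a b (inj₂ (b' , _)) = PredSel a b' b

  φPar : V ⊎ NewV → V ⊎ NewV → Set
  φPar (inj₁ v) y =
      ((∃[ b ] b ∈ s v) × TopOf v y)
    ⊎ ((∀ b → b ∉ s v) × Outer v y)
  φPar (inj₂ (b , _)) y =
      (FirstSel (parent T b) b × Outer (parent T b) y)
    ⊎ PredY (parent T b) b y

  φ : GregTree m
  φ = record { U = NewV ; Par = φPar }

module Submission where

-- The proof reconstructs T and S from the Greg tree φ(S, T) using only notions
-- that are invariant under isomorphism of Greg trees.  In φ(S, T) every
-- labelled vertex a sits at the bottom of a chain u₁ → … → u_j → a of new
-- vertices, one for each selected improper child of a.  Along a chain, the
-- next vertex below u_ℓ is its SPINE child: the child whose subtree has the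
-- largest minimal label (every other child of u_ℓ carries smaller labels).
-- Hence "follow spine children down to a label" recovers the chain of every
-- vertex, and
--   * parent T v = a  iff  the top of v's chain hangs off a's chain by a
--     non-spine edge;
--   * b ∈ S(a)        iff  the top of b's chain is, among the non-spine
--     children of some vertex of a's chain, the one with the largest minimal
--     label.

open import Defs
open import Data.Nat as ℕ using (ℕ; zero; suc; _+_; _*_)
import Data.Nat.Properties as ℕP
open import Data.Fin as Fin using (Fin; toℕ; _≟_)
import Data.Fin.Properties as FinP
open import Data.Fin.Induction using (<-wellFounded; >-wellFounded)
open import Data.Fin.Subset using (_∈_; _∉_)
open import Data.Fin.Subset.Properties using (_∈?_; ⊆-antisym)
open import Data.Vec.Properties.WithK using ([]=-irrelevant)
open import Data.Bool using (Bool; true; false; if_then_else_) renaming (T to IsTrue)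
open import Data.List using (List; []; _∷_; foldr; upTo; allFin)
open import Data.List.Relation.Unary.Any using (here; there; satisfied)
open import Data.List.Relation.Unary.Any.Properties using (any⁺; any⁻)
import Data.List.Membership.Propositional as List
open import Data.List.Membership.Propositional.Properties using (∈-upTo⁺; ∈-allFin)
open import Data.Sum using (_⊎_; inj₁; inj₂)
import Data.Sum.Properties as Sum
open import Data.Product using (Σ; ∃-syntax; _×_; _,_; proj₁; proj₂)
import Data.Product.Properties as Product
open import Data.Unit using (⊤; tt)
open import Data.Empty using (⊥; ⊥-elim)
open import Relation.Nullary using (¬_; yes; no; Dec)
open import Relation.Nullary.Decidable using (⌊_⌋; toWitness; fromWitness; _×-dec_)
open import Relation.Unary using (Decidable)
open import Relation.Binary using (DecidableEquality; TotalPreorder; tri<; tri≈; tri>)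
import Relation.Binary.Construct.Flip.EqAndOrd as Flip
open import Relation.Binary.PropositionalEquality
open import Induction.WellFounded using (Acc; acc)
open import Function using (_∘_)
open import Function.Bundles using (_↔_; _⇔_; Inverse; Equivalence; mk⇔)
open import Function.Properties.Inverse using (↔-sym)

module _ {m : ℕ} where
  private
    V = Fin (suc m)

  Vx : GregTree m → Set
  Vx G = V ⊎ U G

  data Desc (G : GregTree m) : Vx G → Vx G → Set where
    here : ∀ {x} → Desc G x x
    step : ∀ {x y z} → Par G x y → Desc G y z → Desc G x z

  desc-trans : ∀ {G x y z} → Desc G x y → Desc G y z → Desc G x z
  desc-trans here       q = q
  desc-trans (step p d) q = step p (desc-trans d q)

  Lower : (G : GregTree m) → Vx G → Vx G → Set
  Lower G z' z = Σ V λ w → Desc G (inj₁ w) z' × (∀ w' → Desc G (inj₁ w') z → w Fin.< w')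

  Spine : (G : GregTree m) → Vx G → Vx G → Set
  Spine G x z = Par G z x × (∀ z' → Par G z' x → z' ≢ z → Lower G z' z)

  spine-unique : ∀ {G x z z'} → Dec (z ≡ z') → Spine G x z → Spine G x z' → z ≡ z'
  spine-unique (yes z≡z') _ _ = z≡z'
  spine-unique {z = z} {z'} (no z≢z') (pz , others) (pz' , others') with others z' pz' (z≢z' ∘ sym) | others' z pz z≢z'
  ... | w , w↓z' , w-least | w' , w'↓z , w'-least = ⊥-elim (ℕP.<-asym (w-least w' w'↓z) (w'-least w w↓z'))

  data ChainEnd (G : GregTree m) : Vx G → V → Set where
    at-label : ∀ {a} → ChainEnd G (inj₁ a) a
    down     : ∀ {u z a} → Spine G (inj₂ u) z → ChainEnd G z a → ChainEnd G (inj₂ u) a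

  OffSpine : (G : GregTree m) → Vx G → Vx G → Set
  OffSpine G (inj₁ _) x = ⊤
  OffSpine G (inj₂ u) x = ¬ Spine G (inj₂ u) x

  RecParent : (G : GregTree m) → V → V → Set
  RecParent G v a = Σ (Vx G) λ x → Σ (Vx G) λ y →
    ChainEnd G x v × Par G x y × OffSpine G y x × ChainEnd G y a

  LastBranch : (G : GregTree m) → U G → Vx G → Set
  LastBranch G u z =
    ∀ z' → Par G z' (inj₂ u) → OffSpine G (inj₂ u) z' → z' ≢ z → Lower G z' z

  RecSel : (G : GregTree m) → V → V → Set
  RecSel G b a = Σ (U G) λ u → ChainEnd G (inj₂ u) a × Σ (Vx G) λ z →
    Par G z (inj₂ u) × OffSpine G (inj₂ u) z × ChainEnd G z b × LastBranch G u z

  -- an isomorphism of Greg trees (the data of _≅G_), packaged as a record so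
  -- that its endpoints G and H can be inferred
  record Iso (G H : GregTree m) : Set where
    constructor iso
    field
      bij  : U G ↔ U H
      par⇔ : ∀ x y → Par G x y ⇔ Par H (liftV (Inverse.to bij) x) (liftV (Inverse.to bij) y)
  open Iso

  ⇑ : {G H : GregTree m} → Iso G H → Vx G → Vx H
  ⇑ i = liftV (Inverse.to (bij i))

  liftV-inverse : {A B : Set} (f : A ↔ B) (x : V ⊎ B) →
                  liftV (Inverse.to f) (liftV (Inverse.from f) x) ≡ x
  liftV-inverse f (inj₁ v) = refl
  liftV-inverse f (inj₂ u) = cong inj₂ (Inverse.strictlyInverseˡ f u)

  Iso-sym : {G H : GregTree m} → Iso G H → Iso H G
  Iso-sym {G} {H} (iso f h) = iso (↔-sym f) λ x y →
    let e = h (liftV (Inverse.from f) x) (liftV (Inverse.from f) y) in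
    mk⇔ (λ p → Equivalence.from e (subst₂ (Par H) (sym (liftV-inverse f x)) (sym (liftV-inverse f y)) p))
        (λ q → subst₂ (Par H) (liftV-inverse f x) (liftV-inverse f y) (Equivalence.to e q))

  ⇑-inverse : {G H : GregTree m} (i : Iso G H) (x : Vx G) → ⇑ (Iso-sym i) (⇑ i x) ≡ x
  ⇑-inverse i = liftV-inverse (↔-sym (bij i))

  ⇑-onto : {G H : GregTree m} (i : Iso G H) {P : Vx H → Set} → (∀ x → P (⇑ i x)) → ∀ y → P y
  ⇑-onto i {P} h y = subst P (⇑-inverse (Iso-sym i) y) (h (⇑ (Iso-sym i) y))

  Preserved : ((G : GregTree m) → Vx G → Vx G → Set) → Set₁
  Preserved R = ∀ {G H} (i : Iso G H) {x y} → R G x y → R H (⇑ i x) (⇑ i y)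

  reflect : ∀ {R} → Preserved R → ∀ {G H} (i : Iso G H) {x y} → R H (⇑ i x) (⇑ i y) → R G x y
  reflect {R} pres {G} i {x} {y} r = subst₂ (R G) (⇑-inverse i x) (⇑-inverse i y) (pres (Iso-sym i) r)

  par-pres : Preserved Par
  par-pres i {x} {y} = Equivalence.to (par⇔ i x y)

  desc-pres : Preserved Desc
  desc-pres i here       = here
  desc-pres i (step p d) = step (par-pres i p) (desc-pres i d)

  lower-pres : Preserved Lower
  lower-pres i (w , d , least) = w , desc-pres i d , λ w' d' → least w' (reflect desc-pres i d')

  spine-pres : Preserved Spine
  spine-pres i (p , others) = par-pres i p , ⇑-onto i λ z' p' z'≢z →
    lower-pres i (others z' (reflect par-pres i p') (λ e → z'≢z (cong (⇑ i) e)))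

  offSpine-pres : Preserved OffSpine
  offSpine-pres i {inj₁ _} _      = tt
  offSpine-pres i {inj₂ _} ¬spine = ¬spine ∘ reflect spine-pres i

  chainEnd-pres : ∀ {G H} (i : Iso G H) {x a} → ChainEnd G x a → ChainEnd H (⇑ i x) a
  chainEnd-pres i at-label   = at-label
  chainEnd-pres i (down p c) = down (spine-pres i p) (chainEnd-pres i c)

  recParent-pres : ∀ {G H} (i : Iso G H) {v a} → RecParent G v a → RecParent H v a
  recParent-pres i (x , y , cx , p , off , cy) =
    ⇑ i x , ⇑ i y , chainEnd-pres i cx , par-pres i p , offSpine-pres i {y} off , chainEnd-pres i cy

  lastBranch-pres : ∀ {G H} (i : Iso G H) {u z} → LastBranch G u z →
                    LastBranch H (Inverse.to (bij i) u) (⇑ i z)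
  lastBranch-pres i {u} last = ⇑-onto i λ z' p' off' z'≢z →
    lower-pres i (last z' (reflect par-pres i p') (reflect offSpine-pres i {inj₂ u} off')
                          (λ e → z'≢z (cong (⇑ i) e)))

  recSel-pres : ∀ {G H} (i : Iso G H) {b a} → RecSel G b a → RecSel H b a
  recSel-pres i (u , cu , z , p , off , cz , last) =
    Inverse.to (bij i) u , chainEnd-pres i cu , ⇑ i z , par-pres i p ,
    offSpine-pres i {inj₂ u} off , chainEnd-pres i cz , lastBranch-pres i last

iter-suc : ∀ {A : Set} (f : A → A) k x → iter f (suc k) x ≡ iter f k (f x)
iter-suc f zero    x = refl
iter-suc f (suc k) x = cong f (iter-suc f k x)

iter-+ : ∀ {A : Set} (f : A → A) j k x → iter f (j + k) x ≡ iter f j (iter f k x)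
iter-+ f zero    k x = refl
iter-+ f (suc j) k x = cong f (iter-+ f j k x)

-- Facts on a rooted tree given by its parent map: the walk to the root has no
-- cycles other than the loop at the root, so descent is decided by the
-- bounded test desc?, and β v is the least descendant of v.
module RootedTree {m : ℕ} (T : Tree m) where
  private
    V = Fin (suc m)
    p = parent T

  _⊑_ : V → V → Set
  w ⊑ v = ∃[ k ] iter p k w ≡ v

  ⊑-refl : ∀ {w} → w ⊑ w
  ⊑-refl = 0 , refl

  ⊑-up : ∀ {w v} → p w ⊑ v → w ⊑ v
  ⊑-up {w} (k , e) = suc k , trans (iter-suc p k w) e

  ⊑-trans : ∀ {u w v} → u ⊑ w → w ⊑ v → u ⊑ v
  ⊑-trans {u} (k , e) (j , e') = j + k , trans (iter-+ p j k u) (trans (cong (iter p j) e) e')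

  ⊑-shorter : ∀ {w c b k k'} → iter p k w ≡ c → iter p k' w ≡ b → k ℕ.≤ k' → c ⊑ b
  ⊑-shorter {w} {k = k} {k'} e e' k≤k' with ℕP.m≤n⇒∃[o]m+o≡n k≤k'
  ... | o , eo = o , trans (cong (iter p o) (sym e))
                   (trans (sym (iter-+ p o k w)) (trans (cong (λ z → iter p z w) (trans (ℕP.+-comm o k) eo)) e'))

  ⊑-linear : ∀ {w c b} → w ⊑ c → w ⊑ b → c ⊑ b ⊎ b ⊑ c
  ⊑-linear (k , e) (k' , e') with k ℕ.≤? k'
  ... | yes k≤k' = inj₁ (⊑-shorter e e' k≤k')
  ... | no  k≰k' = inj₂ (⊑-shorter e' e (ℕP.<⇒≤ (ℕP.≰⇒> k≰k')))

  root-fixed : ∀ k → iter p k Fin.zero ≡ Fin.zero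
  root-fixed zero    = refl
  root-fixed (suc k) = trans (cong p (root-fixed k)) (parent-root T)

  stays-at-root : ∀ {w K} k → iter p K w ≡ Fin.zero → iter p (k + K) w ≡ Fin.zero
  stays-at-root {w} {K} k e = trans (iter-+ p k K w) (trans (cong (iter p k) e) (root-fixed k))

  periodic : ∀ {a} d i → iter p (d + i) a ≡ iter p i a → ∀ t → iter p (t * d + i) a ≡ iter p i a
  periodic d i e zero = refl
  periodic {a} d i e (suc t) = begin
      iter p ((d + t * d) + i) a      ≡⟨ cong (λ z → iter p z a) (ℕP.+-assoc d (t * d) i) ⟩
      iter p (d + (t * d + i)) a      ≡⟨ iter-+ p d (t * d + i) a ⟩
      iter p d (iter p (t * d + i) a) ≡⟨ cong (iter p d) (periodic d i e t) ⟩
      iter p d (iter p i a)           ≡⟨ sym (iter-+ p d i a) ⟩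
      iter p (d + i) a                ≡⟨ e ⟩
      iter p i a                      ∎
    where open ≡-Reasoning

  -- the only cycle of the parent map is the loop at the root: a walk that
  -- returns to a vertex is at the root, since it must eventually reach it
  cycle-at-root : ∀ {a} d i → iter p (suc d + i) a ≡ iter p i a → iter p i a ≡ Fin.zero
  cycle-at-root {a} d i e with reaches T a
  ... | K , eK with ℕP.m≤n⇒∃[o]m+o≡n (ℕP.≤-trans (ℕP.m≤m*n K (suc d)) (ℕP.m≤m+n (K * suc d) i))
  ...   | o , eo = trans (sym (periodic (suc d) i e K))
                     (subst (λ z → iter p z a ≡ Fin.zero) (trans (ℕP.+-comm o K) eo) (stays-at-root o eK))

  cycle-root : ∀ {a} d → iter p (suc d) a ≡ a → a ≡ Fin.zero
  cycle-root {a} d e = cycle-at-root d 0 (trans (cong (λ z → iter p z a) (ℕP.+-identityʳ (suc d))) e)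

  no-loop : ∀ {v} → v ≢ Fin.zero → p v ≢ v
  no-loop v≢0 e = v≢0 (cycle-root 0 e)

  -- every vertex reaches the root in at most m steps (pigeonhole on the walk)
  short-to-root : ∀ w → ∃[ R ] R ℕ.< suc m × iter p R w ≡ Fin.zero
  short-to-root w with FinP.pigeonhole (ℕP.n<1+n (suc m)) (λ i → iter p (toℕ i) w)
  ... | i , j , i<j , eq with ℕP.m≤n⇒∃[o]m+o≡n i<j
  ...   | o , eo = toℕ i , ℕP.<-≤-trans i<j (ℕP.≤-pred (FinP.toℕ<n j)) ,
          cycle-at-root o (toℕ i)
            (sym (trans eq (cong (λ z → iter p z w) (trans (sym eo) (cong suc (ℕP.+-comm (toℕ i) o))))))

  short-path : ∀ {w v} → w ⊑ v → ∃[ k ] k ℕ.< suc m × iter p k w ≡ v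
  short-path {w} (k , e) with short-to-root w
  ... | R , R< , eR with k ℕ.≤? R
  ... | yes k≤R = k , ℕP.≤-<-trans k≤R R< , e
  ... | no  k≰R with ℕP.m≤n⇒∃[o]m+o≡n (ℕP.≰⇒> k≰R)
  ...   | o , eo = R , R< , trans eR (trans (sym (subst (λ z → iter p z w ≡ Fin.zero)
                     (trans (cong suc (ℕP.+-comm o R)) eo) (stays-at-root (suc o) eR))) e)

  desc?-sound : ∀ {u v} → IsTrue (desc? T u v) → u ⊑ v
  desc?-sound {u} {v} t with satisfied (any⁻ (λ k → ⌊ iter p k u ≟ v ⌋) (upTo (suc m)) t)
  ... | k , tk = k , toWitness tk

  desc?-complete : ∀ {u v} → u ⊑ v → IsTrue (desc? T u v)
  desc?-complete {u} {v} d with short-path d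
  ... | k , k< , e = any⁺ (λ k → ⌊ iter p k u ≟ v ⌋) (List.lose (∈-upTo⁺ k<) (fromWitness e))

  minF-cases : ∀ x y → minF T x y ≡ x ⊎ minF T x y ≡ y
  minF-cases x y with toℕ x ℕ.<? toℕ y
  ... | yes _ = inj₁ refl
  ... | no  _ = inj₂ refl

  minF-≤ˡ : ∀ x y → toℕ (minF T x y) ℕ.≤ toℕ x
  minF-≤ˡ x y with toℕ x ℕ.<? toℕ y
  ... | yes _   = ℕP.≤-refl
  ... | no  x≮y = ℕP.≮⇒≥ x≮y

  minF-≤ʳ : ∀ x y → toℕ (minF T x y) ℕ.≤ toℕ y
  minF-≤ʳ x y with toℕ x ℕ.<? toℕ y
  ... | yes x<y = ℕP.<⇒≤ x<y
  ... | no  _   = ℕP.≤-refl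

  min-fold : (q : V → Bool) (v : V) (xs : List V) →
    let r = foldr (λ u acc → if q u then minF T u acc else acc) v xs in
    (r ≡ v ⊎ IsTrue (q r)) × (∀ u → u List.∈ xs → IsTrue (q u) → toℕ r ℕ.≤ toℕ u)
  min-fold q v [] = inj₁ refl , λ _ ()
  min-fold q v (u ∷ xs) with min-fold q v xs | q u in qu
  ... | found , least | false =
    found , λ { _ (here refl) t → ⊥-elim (subst IsTrue qu t) ; u' (there u'∈) t → least u' u'∈ t }
  ... | found , least | true =
    witness (minF-cases u r) found , λ { _ (here refl) _ → minF-≤ˡ u r
                                        ; u' (there u'∈) t → ℕP.≤-trans (minF-≤ʳ u r) (least u' u'∈ t) }
    where
    r = foldr (λ u acc → if q u then minF T u acc else acc) v xs
    witness : minF T u r ≡ u ⊎ minF T u r ≡ r → r ≡ v ⊎ IsTrue (q r) → minF T u r ≡ v ⊎ IsTrue (q (minF T u r))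
    witness (inj₁ e) _         = inj₂ (subst (IsTrue ∘ q) (sym e) (subst IsTrue (sym qu) tt))
    witness (inj₂ e) (inj₁ e') = inj₁ (trans e e')
    witness (inj₂ e) (inj₂ t)  = inj₂ (subst (IsTrue ∘ q) (sym e) t)

  β-⊑ : ∀ v → β T v ⊑ v
  β-⊑ v with proj₁ (min-fold (λ u → desc? T u v) v (allFin (suc m)))
  ... | inj₁ e = subst (_⊑ v) (sym e) ⊑-refl
  ... | inj₂ t = desc?-sound t

  β-least : ∀ {w v} → w ⊑ v → toℕ (β T v) ℕ.≤ toℕ w
  β-least {w} {v} d = proj₂ (min-fold (λ u → desc? T u v) v (allFin (suc m))) w (∈-allFin w) (desc?-complete d)

  sibling-⊑ : ∀ {a c b} → Child T a c → Child T a b → c ⊑ b → c ≡ b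
  sibling-⊑ _ _ (zero , e) = e
  sibling-⊑ {a} {c} {b} (_ , pc) (b≢0 , pb) (suc o , e) = ⊥-elim (b≢0 b≡0)
    where
    a-to-b : iter p o a ≡ b
    a-to-b = trans (cong (iter p o) (sym pc)) (trans (sym (iter-suc p o c)) e)
    b≡0 : b ≡ Fin.zero
    b≡0 = trans (sym a-to-b)
            (trans (cong (iter p o) (cycle-root o (trans (cong p a-to-b) pb))) (root-fixed o))

  -- siblings have distinct minimal descendants (their subtrees are disjoint)
  sibling-β-injective : ∀ {a c b} → Child T a c → Child T a b → β T c ≡ β T b → c ≡ b
  sibling-β-injective {c = c} {b} cc cb e with ⊑-linear (β-⊑ c) (subst (_⊑ b) (sym e) (β-⊑ b))
  ... | inj₁ c⊑b = sibling-⊑ cc cb c⊑b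
  ... | inj₂ b⊑c = sym (sibling-⊑ cb cc b⊑c)

module Extremum {a ℓ₁ ℓ₂} (O : TotalPreorder a ℓ₁ ℓ₂) where
  open TotalPreorder O using (Carrier; _≲_; total) renaming (refl to ≲-refl; trans to ≲-trans)

  best : ∀ {n} (P : Fin n → Set) → Decidable P → (g : Fin n → Carrier) →
         (∀ x → ¬ P x) ⊎ Σ (Fin n) (λ x → P x × (∀ y → P y → g x ≲ g y))
  best {zero} P P? g = inj₁ λ ()
  best {suc n} P P? g with best (P ∘ Fin.suc) (P? ∘ Fin.suc) (g ∘ Fin.suc) | P? Fin.zero
  ... | inj₁ none | yes p0 = inj₂ (Fin.zero , p0 , λ { Fin.zero _ → ≲-refl ; (Fin.suc y) py → ⊥-elim (none y py) })
  ... | inj₁ none | no ¬p0 = inj₁ λ { Fin.zero → ¬p0 ; (Fin.suc y) → none y }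
  ... | inj₂ (x , px , bx) | no ¬p0 =
    inj₂ (Fin.suc x , px , λ { Fin.zero p0 → ⊥-elim (¬p0 p0) ; (Fin.suc y) py → bx y py })
  ... | inj₂ (x , px , bx) | yes p0 with total (g Fin.zero) (g (Fin.suc x))
  ...   | inj₁ g0≲gx = inj₂ (Fin.zero , p0 , λ { Fin.zero _ → ≲-refl ; (Fin.suc y) py → ≲-trans g0≲gx (bx y py) })
  ...   | inj₂ gx≲g0 = inj₂ (Fin.suc x , px , λ { Fin.zero _ → gx≲g0 ; (Fin.suc y) py → bx y py })

argmin : ∀ {n} (P : Fin n → Set) → Decidable P → (g : Fin n → ℕ) →
         (∀ x → ¬ P x) ⊎ Σ (Fin n) (λ x → P x × (∀ y → P y → g x ℕ.≤ g y))
argmin = Extremum.best ℕP.≤-totalPreorder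

argmax : ∀ {n} (P : Fin n → Set) → Decidable P → (g : Fin n → ℕ) →
         (∀ x → ¬ P x) ⊎ Σ (Fin n) (λ x → P x × (∀ y → P y → g y ℕ.≤ g x))
argmax = Extremum.best (Flip.totalPreorder ℕP.≤-totalPreorder)

module Chains {m : ℕ} (T : Tree m) (S : Sel T) where
  open RootedTree T
  private
    V = Fin (suc m)
    s = sel S
    G = φ T S
    W = Vx G
    B : V → ℕ
    B v = toℕ (β T v)

  sel-child : ∀ {a b} → b ∈ s a → Child T a b
  sel-child {a} {b} i = proj₁ (sound S a b i)

  sel-parent : ∀ {a b} → b ∈ s a → parent T b ≡ a
  sel-parent i = proj₂ (sel-child i)

  sel-nonroot : ∀ {a b} → b ∈ s a → b ≢ Fin.zero
  sel-nonroot i = proj₁ (sel-child i)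

  sel-improper : ∀ {a b} → b ∈ s a → B b ℕ.< toℕ a
  sel-improper {a} {b} i = proj₂ (sound S a b i)

  u⟨_⟩ : ∀ {a b} → b ∈ s a → NewV T S
  u⟨_⟩ {b = b} i = b , subst (λ z → b ∈ s z) (sym (sel-parent i)) i

  u-≡ : ∀ {b b'} {i : b ∈ s (parent T b)} {i' : b' ∈ s (parent T b')} →
        b ≡ b' → _≡_ {A = NewV T S} (b , i) (b' , i')
  u-≡ refl = cong (_ ,_) ([]=-irrelevant _ _)

  _≟ᵥ_ : DecidableEquality W
  _≟ᵥ_ = Sum.≡-dec _≟_ (Product.≡-dec _≟_ λ i i' → yes ([]=-irrelevant i i'))

  -- the labelled vertex at the bottom of the chain containing x
  owner : W → V
  owner (inj₁ v)       = v
  owner (inj₂ (b , _)) = parent T b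

  Top : V → W → Set
  Top c (inj₁ v)       = (v ≡ c) × (∀ b → b ∉ s c)
  Top c (inj₂ (b , _)) = FirstSel T S c b

  Next : V → W → Set
  Next b (inj₁ v)        = (v ≡ parent T b) × LastSel T S (parent T b) b
  Next b (inj₂ (b₂ , _)) = PredSel T S (parent T b) b b₂

  ChainEdge : W → W → Set
  ChainEdge x (inj₁ _)      = ⊥
  ChainEdge x (inj₂ (b , _)) = Next b x

  top-exists : ∀ c → Σ W (Top c)
  top-exists c with argmin (λ b → b ∈ s c) (λ b → b ∈? s c) B
  ... | inj₁ none               = inj₁ c , refl , none
  ... | inj₂ (b , i , earliest) = inj₂ u⟨ i ⟩ , i , earliest

  top-owner : ∀ {c x} → Top c x → owner x ≡ c
  top-owner {x = inj₁ _} (e , _) = e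
  top-owner {x = inj₂ _} (i , _) = sel-parent i

  top-unique : ∀ {c x x'} → Top c x → Top c x' → x ≡ x'
  top-unique {x = inj₁ _} {inj₁ _} (e , _) (e' , _) = cong inj₁ (trans e (sym e'))
  top-unique {x = inj₁ _} {inj₂ _} (_ , none) (i , _) = ⊥-elim (none _ i)
  top-unique {x = inj₂ _} {inj₁ _} (i , _) (_ , none) = ⊥-elim (none _ i)
  top-unique {x = inj₂ (b , _)} {inj₂ (b' , _)} (i , earliest) (i' , earliest') =
    cong inj₂ (u-≡ (sibling-β-injective (sel-child i) (sel-child i')
                      (FinP.≤-antisym (earliest b' i') (earliest' b i))))

  next-exists : ∀ {b} → b ∈ s (parent T b) → Σ W (Next b)
  next-exists {b} i with argmin (λ b' → b' ∈ s (parent T b) × B b ℕ.< B b')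
                                (λ b' → (b' ∈? s (parent T b)) ×-dec (B b ℕ.<? B b')) B
  ... | inj₁ none = inj₁ (parent T b) , refl , i , λ b' i' → ℕP.≮⇒≥ (λ lt → none b' (i' , lt))
  ... | inj₂ (b₂ , (i₂ , lt) , earliest) =
    inj₂ u⟨ i₂ ⟩ , i , i₂ , lt , λ b'' i'' lt' → ℕP.≤⇒≯ (earliest b'' (i'' , lt'))

  next-owner : ∀ {b z} → Next b z → owner z ≡ parent T b
  next-owner {z = inj₁ _} (e , _)     = e
  next-owner {z = inj₂ _} (_ , i , _) = sel-parent i

  next-unique : ∀ {b z z'} → Next b z → Next b z' → z ≡ z'
  next-unique {z = inj₁ _} {inj₁ _} (e , _) (e' , _) = cong inj₁ (trans e (sym e'))
  next-unique {z = inj₁ _} {inj₂ _} (_ , _ , latest) (_ , i , lt , _) = ⊥-elim (ℕP.<⇒≱ lt (latest _ i))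
  next-unique {z = inj₂ _} {inj₁ _} (_ , i , lt , _) (_ , _ , latest) = ⊥-elim (ℕP.<⇒≱ lt (latest _ i))
  next-unique {b} {inj₂ (b₂ , _)} {inj₂ (b₃ , _)} (_ , i₂ , lt₂ , gap₂) (_ , i₃ , lt₃ , gap₃)
    with ℕP.<-cmp (B b₂) (B b₃)
  ... | tri< b₂<b₃ _ _ = ⊥-elim (gap₃ b₂ i₂ lt₂ b₂<b₃)
  ... | tri> _ _ b₃<b₂ = ⊥-elim (gap₂ b₃ i₃ lt₃ b₃<b₂)
  ... | tri≈ _ b₂≈b₃ _ =
    cong inj₂ (u-≡ (sibling-β-injective (sel-child i₂) (sel-child i₃) (FinP.toℕ-injective b₂≈b₃)))

  next-edge : ∀ {b z} (i : b ∈ s (parent T b)) → Next b z → φPar T S z (inj₂ (b , i))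
  next-edge {b} {inj₁ _} i (refl , latest)          = inj₁ ((b , i) , latest)
  next-edge {b} {inj₂ (b₂ , _)} i pred@(_ , i₂ , _) =
    inj₂ (subst (λ a → PredSel T S a b b₂) (sym (sel-parent i₂)) pred)

  edge-cases : ∀ {x y} → φPar T S x y → ChainEdge x y ⊎ (Top (owner x) x × Outer T S (owner x) y)
  edge-cases {inj₁ _} {inj₂ (b , _)} (inj₁ (_ , latest@(i , _))) =
    inj₁ (sym (sel-parent i) , subst (λ a → LastSel T S a b) (sym (sel-parent i)) latest)
  edge-cases {inj₁ _}      (inj₂ (none , out)) = inj₂ ((refl , none) , out)
  edge-cases {inj₂ _}      (inj₁ (earliest , out)) = inj₂ (earliest , out)
  edge-cases {inj₂ (b , _)} {inj₂ (b' , _)} (inj₂ pred@(i' , _)) =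
    inj₁ (subst (λ a → PredSel T S a b' b) (sym (sel-parent i')) pred)

  top-edge : ∀ {v x y} → Top v x → Outer T S v y → φPar T S x y
  top-edge {x = inj₁ _} (refl , none) out = inj₂ (none , out)
  top-edge {x = inj₂ (b , _)} {y} earliest@(i , _) out =
    inj₁ (subst (λ a → FirstSel T S a b × Outer T S a y) (sym (sel-parent i)) (earliest , out))

  outer-owner : ∀ {v y} → Outer T S v y → owner y ≡ parent T v
  outer-owner {y = inj₁ _} ((_ , e) , _) = sym e
  outer-owner {y = inj₂ _} (_ , i , _)   = sel-parent i

  moved-to : ∀ {v b*} → Child T (parent T v) v → b* ∈ s (parent T v) → B v ℕ.≤ B b* →
             (∀ b → b ∈ s (parent T v) → B v ℕ.≤ B b → B b* ℕ.≤ B b) → MovedTo T S v b*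
  moved-to {v} ch i* v≤b* earliest = ch , i* ,
    (v , (ch , ℕP.≤-<-trans v≤b* (sel-improper i*)) ,
         (λ b i b<b* → ℕP.≰⇒> (λ b≤v → ℕP.<⇒≱ b<b* (earliest b i b≤v))) , ℕP.≤-refl) ,
    v≤b*

  moved-self : ∀ {b} → b ∈ s (parent T b) → MovedTo T S b b
  moved-self i = moved-to (sel-nonroot i , refl) i ℕP.≤-refl (λ _ _ le → le)

  unmoved-above : ∀ {a c} → Child T a c → (∀ b → ¬ MovedTo T S c b) → ∀ b → b ∈ s a → B b ℕ.< B c
  unmoved-above {a} {c} ch@(_ , refl) unmoved b i with B b ℕ.<? B c
  ... | yes b<c = b<c
  ... | no  b≮c with argmin (λ b* → b* ∈ s a × B c ℕ.≤ B b*) (λ b* → (b* ∈? s a) ×-dec (B c ℕ.≤? B b*)) B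
  ...   | inj₁ none = ⊥-elim (none b (i , ℕP.≮⇒≥ b≮c))
  ...   | inj₂ (b* , (i* , c≤b*) , earliest) =
    ⊥-elim (unmoved b* (moved-to ch i* c≤b* (λ b' i' le → earliest b' (i' , le))))

  outer-exists : ∀ {v} → v ≢ Fin.zero → Σ W (Outer T S v)
  outer-exists {v} v≢0 with argmin (λ b → b ∈ s (parent T v) × B v ℕ.≤ B b)
                                   (λ b → (b ∈? s (parent T v)) ×-dec (B v ℕ.≤? B b)) B
  ... | inj₁ none = inj₁ (parent T v) , (v≢0 , refl) , λ b (_ , i , _ , le) → none b (i , le)
  ... | inj₂ (b* , (i* , v≤b*) , earliest) =
    inj₂ u⟨ i* ⟩ , moved-to (v≢0 , refl) i* v≤b* (λ b i le → earliest b (i , le))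

  -- HangsBelow x c: the T-child c of owner x hangs in φ(S, T) at x or
  -- further down the chain, i.e. β c exceeds the β of every selected child
  -- whose chain vertex lies above x
  HangsBelow : W → V → Set
  HangsBelow (inj₁ a)       c = ∀ b → b ∈ s a → B b ℕ.< B c
  HangsBelow (inj₂ (b , _)) c = ∀ b' → b' ∈ s (parent T b) → B b' ℕ.< B b → B b' ℕ.< B c

  InBranch : W → V → Set
  InBranch x w = Σ V λ c → Child T (owner x) c × w ⊑ c × HangsBelow x c

  OnChainBelow : W → V → Set
  OnChainBelow (inj₁ _)       b' = ⊥
  OnChainBelow (inj₂ (b , _)) b' = (parent T b' ≡ parent T b) × (B b ℕ.≤ B b')

  -- an over-approximation of the descendants of x in φ(S, T)
  Region : W → W → Set
  Region x (inj₁ w)        = (w ≡ owner x) ⊎ InBranch x w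
  Region x (inj₂ (b' , _)) = OnChainBelow x b' ⊎ InBranch x (parent T b')

  hangs-below-all : ∀ x c → (∀ b → b ∈ s (owner x) → B b ℕ.< B c) → HangsBelow x c
  hangs-below-all (inj₁ _) c above = above
  hangs-below-all (inj₂ _) c above b i _ = above b i

  branch-up : ∀ {x v} → InBranch x (parent T v) → InBranch x v
  branch-up (c , ch , pv⊑c , hangs) = c , ch , ⊑-up pv⊑c , hangs

  outer-region : ∀ {x v y} → Outer T S v y → Region x y → InBranch x v
  outer-region {x} {v} {inj₁ _} (ch , unmoved) (inj₁ refl) =
    v , ch , ⊑-refl , hangs-below-all x v (unmoved-above ch unmoved)
  outer-region {x} {v} {inj₁ _} out@((_ , e) , _) (inj₂ br) =
    branch-up (subst (InBranch x) (sym e) br)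
  outer-region {x} {v} {inj₂ _} out@(_ , i , _) (inj₂ br) =
    branch-up (subst (InBranch x) (sel-parent i) br)
  outer-region {inj₂ (b , _)} {v} {inj₂ (b' , _)} (ch , i' , (d , _ , gap , d≤v) , _) (inj₁ (e , b≤b')) =
    v , subst (λ a → Child T a v) same-owner ch , ⊑-refl ,
    λ b'' i'' b''<b → ℕP.<-≤-trans (gap b'' (subst (λ a → b'' ∈ s a) (sym same-owner) i'')
                                          (ℕP.<-≤-trans b''<b b≤b'))
                                   d≤v
    where
    same-owner : parent T v ≡ parent T b
    same-owner = trans (sym (sel-parent i')) e

  region-refl : ∀ x → Region x x
  region-refl (inj₁ _) = inj₁ refl
  region-refl (inj₂ _) = inj₁ (refl , ℕP.≤-refl)

  region-step : ∀ {x w y} → φPar T S w y → Region x y → Region x w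
  region-step {w = inj₁ _} {inj₁ _} (inj₁ (_ , ()))
  region-step {inj₁ _} {inj₁ _} {inj₂ _} (inj₁ _) (inj₁ ())
  region-step {inj₂ _} {inj₁ _} {inj₂ _} (inj₁ (_ , i' , _)) (inj₁ (e , _)) = inj₁ (trans (sym (sel-parent i')) e)
  region-step {x} {inj₁ _} {inj₂ _} (inj₁ (_ , i' , _)) (inj₂ br) = inj₂ (subst (InBranch x) (sel-parent i') br)
  region-step {x} {inj₁ _} (inj₂ (_ , out)) r = inj₂ (outer-region out r)
  region-step {x} {inj₂ _} (inj₁ (_ , out)) r = inj₂ (outer-region out r)
  region-step {w = inj₂ _} {inj₁ _} (inj₂ ())
  region-step {inj₁ _} {inj₂ _} {inj₂ _} (inj₂ _) (inj₁ ())
  region-step {inj₂ _} {inj₂ _} {inj₂ _} (inj₂ (i' , _ , b'<b'' , _)) (inj₁ (e , b≤b')) =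
    inj₁ (trans (sym (sel-parent i')) e , ℕP.≤-trans b≤b' (ℕP.<⇒≤ b'<b''))
  region-step {x} {inj₂ _} {inj₂ _} (inj₂ (i' , _)) (inj₂ br) = inj₂ (subst (InBranch x) (sel-parent i') br)

  region : ∀ {w x} → Desc G w x → Region x w
  region {x = x} here = region-refl x
  region (step p d)   = region-step p (region d)

  region-⊑ : ∀ {x w} → Region x (inj₁ w) → w ⊑ owner x
  region-⊑ (inj₁ refl)                  = ⊑-refl
  region-⊑ (inj₂ (c , (_ , pc) , w⊑c , _)) = ⊑-trans w⊑c (⊑-up (subst (parent T c ⊑_) pc ⊑-refl))

  top-labels-bound : ∀ {c x w} → Top c x → Desc G (inj₁ w) x → B c ℕ.≤ toℕ w
  top-labels-bound top d = subst (λ a → B a ℕ.≤ _) (top-owner top) (β-least (region-⊑ (region d)))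

  hangs-below-next : ∀ {b z c} → b ∈ s (parent T b) → Next b z → HangsBelow z c → B b ℕ.< B c
  hangs-below-next {z = inj₁ _} i (refl , _) hangs = hangs _ i
  hangs-below-next {z = inj₂ _} i (_ , i₂ , b<b₂ , _) hangs =
    hangs _ (subst (λ a → _ ∈ s a) (sym (sel-parent i₂)) i) b<b₂

  next-labels-bound : ∀ {b z w} → b ∈ s (parent T b) → Next b z → Desc G (inj₁ w) z → B b ℕ.< toℕ w
  next-labels-bound {b} i nx d with region d
  ... | inj₁ refl = subst (λ a → B b ℕ.< toℕ a) (sym (next-owner nx)) (sel-improper i)
  ... | inj₂ (c , _ , w⊑c , hangs) = ℕP.<-≤-trans (hangs-below-next i nx hangs) (β-least w⊑c)

  along-chain : (P : V → W → Set) → (∀ a → P a (inj₁ a)) →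
    (∀ {b z} (i : b ∈ s (parent T b)) → Next b z → P (parent T b) z → P (parent T b) (inj₂ (b , i))) →
    ∀ x → P (owner x) x
  along-chain P base up (inj₁ a)       = base a
  along-chain P base up (inj₂ (b , i)) = climb b i (>-wellFounded (β T b))
    where
    climb : ∀ b (i : b ∈ s (parent T b)) → Acc Fin._>_ (β T b) → P (parent T b) (inj₂ (b , i))
    climb b i (acc further) with next-exists i
    ... | inj₁ v , nx@(v≡pb , _) = up i nx (subst (λ a → P a (inj₁ v)) v≡pb (base v))
    ... | inj₂ (b₂ , i₂) , nx@(_ , i₂' , b<b₂ , _) =
      up i nx (subst (λ a → P a (inj₂ (b₂ , i₂))) (sel-parent i₂') (climb b₂ i₂ (further b<b₂)))

  owner-below : ∀ x → Desc G (inj₁ (owner x)) x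
  owner-below = along-chain (λ a x → Desc G (inj₁ a) x) (λ _ → here)
                            (λ i nx d → desc-trans d (step (next-edge i nx) here))

  below-top : ∀ {b} (i : b ∈ s (parent T b)) {x} → Top (parent T b) x → Desc G (inj₂ (b , i)) x
  below-top {b} i = descend b i (<-wellFounded (β T b))
    where
    descend : ∀ b (i : b ∈ s (parent T b)) → Acc Fin._<_ (β T b) →
              ∀ {x} → Top (parent T b) x → Desc G (inj₂ (b , i)) x
    descend b i (acc further) {x} top
      with argmax (λ b' → b' ∈ s (parent T b) × B b' ℕ.< B b)
                  (λ b' → (b' ∈? s (parent T b)) ×-dec (B b' ℕ.<? B b)) B
    ... | inj₁ none = subst (Desc G (inj₂ (b , i))) (top-unique {x = inj₂ (b , i)} earliest top) here
      where earliest : FirstSel T S (parent T b) b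
            earliest = i , λ b' i' → ℕP.≮⇒≥ (λ b'<b → none b' (i' , b'<b))
    ... | inj₂ (b₀ , (i₀ , b₀<b) , latest) =
      step (inj₂ (i₀ , i , b₀<b , λ b'' i'' b₀<b'' b''<b → ℕP.<⇒≱ b₀<b'' (latest b'' (i'' , b''<b))))
           (descend b₀ (subst (λ a → b₀ ∈ s a) (sym (sel-parent i₀)) i₀) (further b₀<b)
                    (subst (λ a → Top a x) (sym (sel-parent i₀)) top))

  below-own-top : ∀ {c x} → Top c x → Desc G (inj₁ c) x
  below-own-top {x = inj₁ _} (refl , _) = here
  below-own-top {x = inj₂ (b , i)} (i' , _) =
    subst (λ a → Desc G (inj₁ a) _) (sel-parent i') (owner-below (inj₂ (b , i)))

  outer-below-top : ∀ {v y x} → Outer T S v y → Top (parent T v) x → Desc G y x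
  outer-below-top {y = inj₁ _} ((_ , e) , _) top = below-own-top (subst (λ a → Top a _) e top)
  outer-below-top {y = inj₂ (b , i)} (_ , i' , _) top = below-top i (subst (λ a → Top a _) (sym (sel-parent i')) top)

  top-below-parent-top : ∀ {v x x'} → v ≢ Fin.zero → Top v x → Top (parent T v) x' → Desc G x x'
  top-below-parent-top v≢0 top top' with outer-exists v≢0
  ... | y , out = step (top-edge top out) (outer-below-top out top')

  tops-ascend : ∀ k {w c x x'} → iter (parent T) k w ≡ c → Top w x → Top c x' → Desc G x x'
  tops-ascend zero refl top top' = subst (Desc G _) (top-unique top top') here
  tops-ascend (suc k) {w} e top top' with w ≟ Fin.zero
  ... | yes refl = tops-ascend zero (trans (sym (root-fixed (suc k))) e) top top'
  ... | no w≢0 with top-exists (parent T w)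
  ...   | x , top-pw = desc-trans (top-below-parent-top w≢0 top top-pw)
                                  (tops-ascend k (trans (sym (iter-suc (parent T) k w)) e) top-pw top')

  ⊑-below-top : ∀ {w c x} → w ⊑ c → Top c x → Desc G (inj₁ w) x
  ⊑-below-top {w} (k , e) top with top-exists w
  ... | x , top-w = desc-trans (below-own-top top-w) (tops-ascend k e top-w top)

  top-lower : ∀ {c x z} → Top c x → (∀ w → Desc G (inj₁ w) z → B c ℕ.< toℕ w) → Lower G x z
  top-lower {c} top above = β T c , ⊑-below-top (β-⊑ c) top , above

  -- the next vertex of a chain is the spine child: the other children of
  -- u_b are tops of children moved to u_b, whose β is at most β b
  next-spine : ∀ {b z} (i : b ∈ s (parent T b)) → Next b z → Spine G (inj₂ (b , i)) z
  next-spine {b} {z} i nx = next-edge i nx , others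
    where
    others : ∀ z' → φPar T S z' (inj₂ (b , i)) → z' ≢ z → Lower G z' z
    others z' p z'≢z with edge-cases p
    ... | inj₁ nx' = ⊥-elim (z'≢z (next-unique nx' nx))
    ... | inj₂ (top , (_ , _ , _ , c≤b)) =
      top-lower top λ w d → ℕP.≤-<-trans c≤b (next-labels-bound i nx d)

  spine-next : ∀ {b z} (i : b ∈ s (parent T b)) → Spine G (inj₂ (b , i)) z → Next b z
  spine-next {b} {z} i sp with next-exists i
  ... | z₀ , nx = subst (Next b) (sym (spine-unique (z ≟ᵥ z₀) sp (next-spine i nx))) nx

  chainEnd-owner : ∀ {x a} → ChainEnd G x a → owner x ≡ a
  chainEnd-owner at-label = refl
  chainEnd-owner {inj₂ (_ , i)} (down sp c) = trans (sym (next-owner (spine-next i sp))) (chainEnd-owner c)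

  chainEnd-exists : ∀ x → ChainEnd G x (owner x)
  chainEnd-exists = along-chain (λ a x → ChainEnd G x a) (λ _ → at-label) (λ i nx c → down (next-spine i nx) c)

  chainEnd-top : ∀ {c x} → Top c x → ChainEnd G x c
  chainEnd-top {x = x} top = subst (ChainEnd G x) (top-owner top) (chainEnd-exists x)

  chain-edge-spine : ∀ {x y} → ChainEdge x y → ¬ OffSpine G y x
  chain-edge-spine {y = inj₂ (_ , i)} nx off = off (next-spine i nx)

  top-off-spine : ∀ {c x b} (i : b ∈ s (parent T b)) → c ≢ Fin.zero → Top c x →
                  parent T b ≡ parent T c → OffSpine G (inj₂ (b , i)) x
  top-off-spine i c≢0 top e sp =
    no-loop c≢0 (sym (trans (sym (top-owner top)) (trans (next-owner (spine-next i sp)) e)))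

  off-spine-child : ∀ {b z} (i : b ∈ s (parent T b)) → φPar T S z (inj₂ (b , i)) → OffSpine G (inj₂ (b , i)) z →
                    Top (owner z) z × MovedTo T S (owner z) b
  off-spine-child i p off with edge-cases p
  ... | inj₁ nx    = ⊥-elim (chain-edge-spine nx off)
  ... | inj₂ moved = moved

  recParent-complete : ∀ {v} → v ≢ Fin.zero → RecParent G v (parent T v)
  recParent-complete {v} v≢0 with top-exists v | outer-exists v≢0
  ... | x , top | y , out =
    x , y , chainEnd-top top , top-edge top out , off-spine y out ,
    subst (ChainEnd G y) (outer-owner out) (chainEnd-exists y)
    where
    off-spine : ∀ y → Outer T S v y → OffSpine G y x
    off-spine (inj₁ _) _ = tt
    off-spine (inj₂ (_ , i)) out = top-off-spine i v≢0 top (outer-owner {y = inj₂ (_ , i)} out)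

  recParent-sound : ∀ {v a} → RecParent G v a → parent T v ≡ a
  recParent-sound {v} {a} (x , y , end-x , p , off , end-y) with edge-cases p
  ... | inj₁ nx        = ⊥-elim (chain-edge-spine nx off)
  ... | inj₂ (_ , out) = begin
      parent T v         ≡⟨ cong (parent T) (sym (chainEnd-owner end-x)) ⟩
      parent T (owner x) ≡⟨ sym (outer-owner out) ⟩
      owner y            ≡⟨ chainEnd-owner end-y ⟩
      a                  ∎
    where open ≡-Reasoning

  -- the top of the chain of a selected b is the last branch of u_b: the other
  -- branches are tops of moved children c ≠ b, so β c < β b
  recSel-complete : ∀ {a b} → b ∈ s a → RecSel G b a
  recSel-complete {a} {b} b∈ with top-exists b
  ... | z , top = ub , subst (ChainEnd G (inj₂ ub)) (sel-parent b∈) (chainEnd-exists (inj₂ ub)) ,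
                  z , top-edge top (moved-self i) , top-off-spine i (sel-nonroot b∈) top refl ,
                  chainEnd-top top , last
    where
    ub = u⟨ b∈ ⟩
    i = proj₂ ub
    last : LastBranch G ub z
    last z' p off z'≢z with off-spine-child i p off
    ... | top' , (ch , i' , _ , c≤b) with owner z' ≟ b
    ...   | yes refl = ⊥-elim (z'≢z (top-unique top' top))
    ...   | no  c≢b  = top-lower top' λ w d →
      ℕP.<-≤-trans (ℕP.≤∧≢⇒< c≤b (c≢b ∘ sibling-β-injective ch (sel-child i') ∘ FinP.toℕ-injective))
                   (top-labels-bound top d)

  -- conversely, if the last branch z of u_{b'} is the top of the chain of b,
  -- then b is moved to u_{b'}; were b ≠ b', the top of b' would be a branch
  -- of u_{b'} with all labels ≥ β b' ≥ β b, so z could not be Lower than it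
  recSel-sound : ∀ {b a} → RecSel G b a → b ∈ s a
  recSel-sound {b} {a} ((b' , i') , end-u , z , p , off , end-z , last) with off-spine-child i' p off
  ... | top , (_ , _ , _ , b≤b') with chainEnd-owner end-z
  ... | refl with owner z ≟ b'
  ...   | yes refl = subst (λ a → owner z ∈ s a) (chainEnd-owner end-u) i'
  ...   | no  b≢b' with top-exists b'
  ...     | z' , top' with last z' (top-edge top' (moved-self i')) (top-off-spine i' (sel-nonroot i') top' refl)
                               (λ e → b≢b' (trans (cong owner (sym e)) (top-owner top')))
  ...       | w , w↓z' , w-least =
    ⊥-elim (ℕP.<-irrefl refl (ℕP.<-≤-trans (w-least (β T b) (⊑-below-top (β-⊑ b) top))
                                            (ℕP.≤-trans b≤b' (top-labels-bound top' w↓z'))))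

-- φ(S, T) determines T via RecParent and S via RecSel, and both are
-- isomorphism invariants.
lemma14 : (m : ℕ) (T T' : Tree m) (S : Sel T) (S' : Sel T') →
    φ T S ≅G φ T' S' →
    (∀ v → parent T v ≡ parent T' v) × (∀ a → sel S a ≡ sel S' a)
lemma14 m T T' S S' (f , h) = same-parent , same-sel
  where
  module C  = Chains T S
  module C' = Chains T' S'

  i : Iso (φ T S) (φ T' S')
  i = iso f h

  same-parent : ∀ v → parent T v ≡ parent T' v
  same-parent v with v ≟ Fin.zero
  ... | yes refl = trans (parent-root T) (sym (parent-root T'))
  ... | no  v≢0  = sym (C'.recParent-sound (recParent-pres i (C.recParent-complete v≢0)))

  same-sel : ∀ a → sel S a ≡ sel S' a
  same-sel a = ⊆-antisym (λ b∈ → C'.recSel-sound (recSel-pres i (C.recSel-complete b∈)))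
                         (λ b∈ → C.recSel-sound (recSel-pres (Iso-sym i) (C'.recSel-complete b∈)))
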